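{- Let $G=(V,E,w)$ be a directed weighted graph, $M=(V_M,E_M)$ a motif, and $G_\sigma$, $f_{u,v,z}$ as described in the context. A map $P:V_M\to V$ is an injective graph homomorphism from $M$ into $G$ (i.e. from $M$ onto a subgraph of $G$) if and only if there is a triangle $u,v,z$ in $G_\sigma$ (with $u\in T_{k_1}$, $v\in T_{k_2}$, $z\in T_{k_3}$) such that $P=f^{ -1}_{u,v,z}$.
   Context: Let $r=|V_M|$ and choose $k_1,k_2,k_3$ with $k_1+k_2+k_3=r$ and $\lfloor r/3\rfloor\le k_i\le\lceil r/3\rceil$. $T_k$ is the set of ordered sequences of $k$ pairwise distinct vertices of $G$. Fix an ordering $\pi$ of $V_M$; $\pi_1$ is its first $k_1$ entries, $\pi_2$ the next $k_2$, $\pi_3$ the remaining $k_3$. For $v=(v_1,\dots,v_{k_i})\in T_{k_i}$, $f_v$ maps $v_\ell\mapsto\pi_{i,\ell}$ (the $\ell$-th entry of $\pi_i$). For $u,v,z$ from the three different parts whose entries are pairwise disjoint, $f_{u,v}=f_u\cup f_v$ and $f_{u,v,z}=f_u\cup f_v\cup f_z$ (bijections onto their images). Such a map $f$ is consistent if $f^{ -1}$ maps every edge of $M$ between vertices of the image of $f$ to an edge of $G$. $G_\sigma$ is the tripartite graph with vertex set the disjoint union $T_{k_1}\sqcup T_{k_2}\sqcup T_{k_3}$, in which $u,v$ are adjacent iff they lie in different parts, their entries are pairwise disjoint, and $f_{u,v}$ is consistent. An injective homomorphism $P:V_M\to V$ is an injective map such that $(P(x),P(y))\in E$ for every $(x,y)\in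 E_M$. -}

module Defs where

open import Data.Nat using (ℕ; _+_; _≤_; _/_)
open import Data.Fin using (Fin; cast; _↑ˡ_; _↑ʳ_)
open import Data.Unit using (⊤)
open import Data.Product using (Σ; ∃; _×_; _,_)
open import Data.Sum using (_⊎_; inj₁; inj₂)
open import Data.Empty using (⊥)
open import Relation.Binary.PropositionalEquality using (_≡_; _≢_)
open import Function.Definitions using (Injective)

T : (n k : ℕ) → Set
T n k = Σ (Fin k → Fin n) (Injective _≡_ _≡_)

floor3 ceil3 : ℕ → ℕ
floor3 r = r / 3
ceil3 r = (r + 2) / 3

module Blocks {r : ℕ} (k1 k2 k3 : ℕ) (eq : k1 + k2 + k3 ≡ r) (π : Fin r → Fin r) where
  π₁ : Fin k1 → Fin r
  π₁ ℓ = π (cast eq ((ℓ ↑ˡ k2) ↑ˡ k3))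
  π₂ : Fin k2 → Fin r
  π₂ ℓ = π (cast eq ((k1 ↑ʳ ℓ) ↑ˡ k3))
  π₃ : Fin k3 → Fin r
  π₃ ℓ = π (cast eq ((k1 + k2) ↑ʳ ℓ))

-- graph (as a relation) of f_v for a sequence v whose ℓ-th entry maps to p ℓ
Maps : {n r k : ℕ} → (Fin k → Fin n) → (Fin k → Fin r) → Fin n → Fin r → Set
Maps {k = k} s p a m = Σ (Fin k) λ ℓ → (s ℓ ≡ a) × (p ℓ ≡ m)

-- consistency of a (partial) map f : V → V_M given by its graph F:
-- f⁻¹ sends every edge of M between image vertices to an edge of G.
Consistent : {n r : ℕ} → (Fin n → Fin n → Set) → (Fin r → Fin r → Set)
           → (Fin n → Fin r → Set) → Set
Consistent {n} {r} E EM F =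
  (a b : Fin n) (m m' : Fin r) → F a m → F b m' → EM m m' → E a b

Disjoint : {n k l : ℕ} → (Fin k → Fin n) → (Fin l → Fin n) → Set
Disjoint {k = k} {l} s t = (i : Fin k) (j : Fin l) → s i ≢ t j

module Gσ {n r : ℕ} (E : Fin n → Fin n → Set) (EM : Fin r → Fin r → Set)
          (k1 k2 k3 : ℕ) (eq : k1 + k2 + k3 ≡ r) (π : Fin r → Fin r) where
  open Blocks k1 k2 k3 eq π

  Vertex : Set
  Vertex = T n k1 ⊎ (T n k2 ⊎ T n k3)

  record Piece : Set where
    constructor piece
    field
      len : ℕ
      seq : Fin len → Fin n
      pos : Fin len → Fin r

  toPiece : Vertex → Piece
  toPiece (inj₁ (u , _)) = piece k1 u π₁
  toPiece (inj₂ (inj₁ (v , _))) = piece k2 v π₂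
  toPiece (inj₂ (inj₂ (z , _))) = piece k3 z π₃

  DifferentParts : Vertex → Vertex → Set
  DifferentParts (inj₁ _) (inj₁ _) = ⊥
  DifferentParts (inj₂ (inj₁ _)) (inj₂ (inj₁ _)) = ⊥
  DifferentParts (inj₂ (inj₂ _)) (inj₂ (inj₂ _)) = ⊥
  DifferentParts _ _ = ⊤

  F2 : Vertex → Vertex → Fin n → Fin r → Set
  F2 x y a m = Maps (Piece.seq (toPiece x)) (Piece.pos (toPiece x)) a m
             ⊎ Maps (Piece.seq (toPiece y)) (Piece.pos (toPiece y)) a m

  F3 : Vertex → Vertex → Vertex → Fin n → Fin r → Set
  F3 x y z a m = F2 x y a m ⊎ Maps (Piece.seq (toPiece z)) (Piece.pos (toPiece z)) a m

  Adj : Vertex → Vertex → Set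
  Adj x y = DifferentParts x y
          × Disjoint (Piece.seq (toPiece x)) (Piece.seq (toPiece y))
          × Consistent E EM (F2 x y)

IsInjHom : {n r : ℕ} → (Fin n → Fin n → Set) → (Fin r → Fin r → Set)
         → (Fin r → Fin n) → Set
IsInjHom {n} {r} E EM P =
  Injective _≡_ _≡_ P × ((x y : Fin r) → EM x y → E (P x) (P y))

-- A triangle u, v, z of G_σ is the same thing as the three restrictions P ∘ π₁, P ∘ π₂, P ∘ π₃
-- of a map P : V_M → V, and f_{u,v,z} is then the partial map whose graph is that of P⁻¹.
-- Because π₁, π₂, π₃ partition V_M, P is injective exactly when each restriction is injective
-- and the three have disjoint images (the vertices of T_k and the disjointness in G_σ), and
-- P is a homomorphism exactly when f_{u,v,z}⁻¹ preserves every edge of M; an edge of M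
-- meets at most two blocks, so this is the consistency of the three pairs f_{u,v}, f_{u,z}, f_{v,z}.
module Submission where

open import Defs
open import Data.Nat using (ℕ; _+_; _≤_)
open import Data.Fin using (Fin; cast; _↑ˡ_; _↑ʳ_; splitAt)
open import Data.Fin.Properties
  using (↑ˡ-injective; ↑ʳ-injective; cast-involutive; splitAt-↑ˡ; splitAt-↑ʳ; splitAt⁻¹-↑ˡ; splitAt⁻¹-↑ʳ)
open import Data.Product using (Σ; ∃; _×_; _,_; proj₁; proj₂)
open import Data.Sum using (inj₁; inj₂; _⊎_; [_,_]′)
open import Data.Unit using (tt)
open import Data.Empty using (⊥; ⊥-elim)
open import Function using (_∘_)
open import Relation.Binary.PropositionalEquality
  using (_≡_; _≢_; refl; sym; trans; cong; subst; subst₂)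
open import Function.Definitions using (Bijective; Injective)
open import Function.Bundles using (_⇔_; mk⇔; Equivalence)

private variable
  n r k l : ℕ

module _ {A B : Set} where

  _∪_ : (A → B → Set) → (A → B → Set) → A → B → Set
  (F ∪ G) a m = F a m ⊎ G a m

  Functional : (A → B → Set) → Set
  Functional F = ∀ {a m m′} → F a m → F a m′ → m ≡ m′

  Apart : (A → B → Set) → (A → B → Set) → Set
  Apart F G = ∀ {a m m′} → F a m → G a m′ → ⊥

  ∪-functional : ∀ {F G} → Functional F → Functional G → Apart F G → Functional (F ∪ G)
  ∪-functional F-fun G-fun F#G (inj₁ p) (inj₁ q) = F-fun p q
  ∪-functional F-fun G-fun F#G (inj₁ p) (inj₂ q) = ⊥-elim (F#G p q)
  ∪-functional F-fun G-fun F#G (inj₂ p) (inj₁ q) = ⊥-elim (F#G q p)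
  ∪-functional F-fun G-fun F#G (inj₂ p) (inj₂ q) = G-fun p q

  ∪-apart : ∀ {F G H} → Apart F H → Apart G H → Apart (F ∪ G) H
  ∪-apart F#H G#H (inj₁ p) q = F#H p q
  ∪-apart F#H G#H (inj₂ p) q = G#H p q

Maps-functional : {s : Fin k → Fin n} {p : Fin k → Fin r} →
                  Injective _≡_ _≡_ s → Functional (Maps s p)
Maps-functional s-inj (i , si≡a , pi≡m) (j , sj≡a , pj≡m′) with s-inj (trans si≡a (sym sj≡a))
... | refl = trans (sym pi≡m) pj≡m′

Maps-apart : {s : Fin k → Fin n} {t : Fin l → Fin n} {p : Fin k → Fin r} {q : Fin l → Fin r} →
             Disjoint s t → Apart (Maps s p) (Maps t q)
Maps-apart s#t (i , si≡a , _) (j , tj≡a , _) = s#t i j (trans si≡a (sym tj≡a))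

Disjoint-∘ : {m : ℕ} {g : Fin m → Fin n} {s : Fin k → Fin m} {t : Fin l → Fin m} →
             Injective _≡_ _≡_ g → Disjoint s t → Disjoint (g ∘ s) (g ∘ t)
Disjoint-∘ g-inj s#t i j = s#t i j ∘ g-inj

module _ (P : Fin r → Fin n) (p : Fin k → Fin r) where

  Maps-∘⇒inverse : ∀ {a m} → Maps (P ∘ p) p a m → P m ≡ a
  Maps-∘⇒inverse (ℓ , Ppℓ≡a , pℓ≡m) = subst (λ x → P x ≡ _) pℓ≡m Ppℓ≡a

  inverse⇒Maps-∘ : ∀ {a m} ℓ → p ℓ ≡ m → P m ≡ a → Maps (P ∘ p) p a m
  inverse⇒Maps-∘ ℓ pℓ≡m Pm≡a = ℓ , trans (cong P pℓ≡m) Pm≡a , pℓ≡m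

module _ (E : Fin n → Fin n → Set) (EM : Fin r → Fin r → Set) where

  Homomorphic : (Fin r → Fin n) → Set
  Homomorphic P = ∀ x y → EM x y → E (P x) (P y)

  homomorphic⇒consistent : ∀ {P} F → Homomorphic P → (∀ {a m} → F a m → P m ≡ a) → Consistent E EM F
  homomorphic⇒consistent {P} F hom F⊆P⁻¹ a b m m′ Fam Fbm′ em =
    subst₂ E (F⊆P⁻¹ Fam) (F⊆P⁻¹ Fbm′) (hom m m′ em)

  consistent⇒homomorphic : ∀ {P} F → (∀ m → F (P m) m) → Consistent E EM F → Homomorphic P
  consistent⇒homomorphic {P} F P⁻¹⊆F F-con x y = F-con (P x) (P y) x y (P⁻¹⊆F x) (P⁻¹⊆F y)

  consistent-∪₃ : ∀ {F G H} → Consistent E EM (F ∪ G) → Consistent E EM (F ∪ H) →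
                  Consistent E EM (G ∪ H) → Consistent E EM ((F ∪ G) ∪ H)
  consistent-∪₃ FG FH GH a b m m′ (inj₁ p) (inj₁ q) = FG a b m m′ p q
  consistent-∪₃ FG FH GH a b m m′ (inj₁ (inj₁ p)) (inj₂ q) = FH a b m m′ (inj₁ p) (inj₂ q)
  consistent-∪₃ FG FH GH a b m m′ (inj₁ (inj₂ p)) (inj₂ q) = GH a b m m′ (inj₁ p) (inj₂ q)
  consistent-∪₃ FG FH GH a b m m′ (inj₂ p) (inj₁ (inj₁ q)) = FH a b m m′ (inj₂ p) (inj₁ q)
  consistent-∪₃ FG FH GH a b m m′ (inj₂ p) (inj₁ (inj₂ q)) = GH a b m m′ (inj₂ p) (inj₁ q)
  consistent-∪₃ FG FH GH a b m m′ (inj₂ p) (inj₂ q) = FH a b m m′ (inj₂ p) (inj₂ q)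

functional⇒injective : {P : Fin r → Fin n} (F : Fin n → Fin r → Set) →
                       (∀ m → F (P m) m) → Functional F → Injective _≡_ _≡_ P
functional⇒injective F P⁻¹⊆F F-fun {x} {y} Px≡Py =
  F-fun (P⁻¹⊆F x) (subst (λ a → F a y) (sym Px≡Py) (P⁻¹⊆F y))

↑ˡ≢↑ʳ : ∀ {m n} (i : Fin m) (j : Fin n) → i ↑ˡ n ≢ m ↑ʳ j
↑ˡ≢↑ʳ {m} {n} i j e with trans (sym (splitAt-↑ˡ m i n)) (trans (cong (splitAt m) e) (splitAt-↑ʳ m n j))
... | ()

cast-injective : ∀ {m n} (eq : m ≡ n) → Injective _≡_ _≡_ (cast eq)
cast-injective eq {i} {j} e =
  trans (sym (cast-involutive (sym eq) eq i)) (trans (cong (cast (sym eq)) e) (cast-involutive (sym eq) eq j))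

module ThreeBlocks (k1 k2 k3 : ℕ) where

  block₁ : Fin k1 → Fin (k1 + k2 + k3)
  block₁ ℓ = (ℓ ↑ˡ k2) ↑ˡ k3

  block₂ : Fin k2 → Fin (k1 + k2 + k3)
  block₂ ℓ = (k1 ↑ʳ ℓ) ↑ˡ k3

  block₃ : Fin k3 → Fin (k1 + k2 + k3)
  block₃ ℓ = (k1 + k2) ↑ʳ ℓ

  block₁-injective : Injective _≡_ _≡_ block₁
  block₁-injective = ↑ˡ-injective k2 _ _ ∘ ↑ˡ-injective k3 _ _

  block₂-injective : Injective _≡_ _≡_ block₂
  block₂-injective = ↑ʳ-injective k1 _ _ ∘ ↑ˡ-injective k3 _ _

  block₃-injective : Injective _≡_ _≡_ block₃
  block₃-injective = ↑ʳ-injective (k1 + k2) _ _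

  block₁#block₂ : Disjoint block₁ block₂
  block₁#block₂ i j = ↑ˡ≢↑ʳ i j ∘ ↑ˡ-injective k3 _ _

  block₁#block₃ : Disjoint block₁ block₃
  block₁#block₃ i = ↑ˡ≢↑ʳ (i ↑ˡ k2)

  block₂#block₃ : Disjoint block₂ block₃
  block₂#block₃ i = ↑ˡ≢↑ʳ (k1 ↑ʳ i)

  InBlock : {k : ℕ} → (Fin k → Fin (k1 + k2 + k3)) → Fin (k1 + k2 + k3) → Set
  InBlock block j = ∃ λ ℓ → block ℓ ≡ j

  blocks-cover : ∀ j → InBlock block₁ j ⊎ InBlock block₂ j ⊎ InBlock block₃ j
  blocks-cover j with splitAt (k1 + k2) j in j≡
  ... | inj₂ ℓ = inj₂ (inj₂ (ℓ , splitAt⁻¹-↑ʳ j≡))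
  ... | inj₁ i with splitAt k1 i in i≡
  ...   | inj₁ ℓ = inj₁ (ℓ , trans (cong (_↑ˡ k3) (splitAt⁻¹-↑ˡ i≡)) (splitAt⁻¹-↑ˡ j≡))
  ...   | inj₂ ℓ = inj₂ (inj₁ (ℓ , trans (cong (_↑ˡ k3) (splitAt⁻¹-↑ʳ i≡)) (splitAt⁻¹-↑ˡ j≡)))

module Triangles (E : Fin n → Fin n → Set) (EM : Fin r → Fin r → Set)
    (k1 k2 k3 : ℕ) (eq : k1 + k2 + k3 ≡ r) (π : Fin r → Fin r) where
  open Blocks k1 k2 k3 eq π
  open Gσ E EM k1 k2 k3 eq π
  open ThreeBlocks k1 k2 k3

  Realises : T n k1 → T n k2 → T n k3 → (Fin r → Fin n) → Set
  Realises u v z P = (a : Fin n) (m : Fin r) → F3 (inj₁ u) (inj₂ (inj₁ v)) (inj₂ (inj₂ z)) a m ⇔ (P m ≡ a)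

  RealisedByTriangle : (Fin r → Fin n) → Set
  RealisedByTriangle P = Σ (T n k1) λ u → Σ (T n k2) λ v → Σ (T n k3) λ z →
    Adj (inj₁ u) (inj₂ (inj₁ v)) × Adj (inj₁ u) (inj₂ (inj₂ z)) × Adj (inj₂ (inj₁ v)) (inj₂ (inj₂ z))
    × Realises u v z P

  injective-hom-of-triangle : ∀ {P} → RealisedByTriangle P → IsInjHom E EM P
  injective-hom-of-triangle {P} (u , v , z , (_ , u#v , uv) , (_ , u#z , uz) , (_ , v#z , vz) , P⁻¹) =
    functional⇒injective f P⁻¹⊆f f-functional , consistent⇒homomorphic E EM f P⁻¹⊆f (consistent-∪₃ E EM uv uz vz)
    where
    fu fv fz f : Fin n → Fin r → Set
    fu = Maps (proj₁ u) π₁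
    fv = Maps (proj₁ v) π₂
    fz = Maps (proj₁ z) π₃
    f = (fu ∪ fv) ∪ fz

    P⁻¹⊆f : ∀ m → f (P m) m
    P⁻¹⊆f m = Equivalence.from (P⁻¹ (P m) m) refl

    f-functional : Functional f
    f-functional =
      ∪-functional {F = fu ∪ fv} {G = fz}
        (∪-functional {F = fu} {G = fv} (Maps-functional (proj₂ u)) (Maps-functional (proj₂ v)) (Maps-apart u#v))
        (Maps-functional (proj₂ z))
        (∪-apart {F = fu} {G = fv} {H = fz} (Maps-apart u#z) (Maps-apart v#z))

  module _ (π-bij : Bijective _≡_ _≡_ π) where

    position : Fin (k1 + k2 + k3) → Fin r
    position = π ∘ cast eq

    position-injective : Injective _≡_ _≡_ position
    position-injective = cast-injective eq ∘ proj₁ π-bij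

    position-surjective : ∀ m → ∃ λ j → position j ≡ m
    position-surjective m with proj₂ π-bij m
    ... | x , πx≡m = cast (sym eq) x , trans (cong π (cast-involutive eq (sym eq) x)) (πx≡m refl)

    triangle-of-injective-hom : ∀ {P} → IsInjHom E EM P → RealisedByTriangle P
    triangle-of-injective-hom {P} (P-inj , P-hom) =
      u , v , z ,
      (tt , Disjoint-∘ P∘position-injective block₁#block₂ , homomorphic⇒consistent E EM _ P-hom [ F⊆P⁻¹ π₁ , F⊆P⁻¹ π₂ ]′) ,
      (tt , Disjoint-∘ P∘position-injective block₁#block₃ , homomorphic⇒consistent E EM _ P-hom [ F⊆P⁻¹ π₁ , F⊆P⁻¹ π₃ ]′) ,
      (tt , Disjoint-∘ P∘position-injective block₂#block₃ , homomorphic⇒consistent E EM _ P-hom [ F⊆P⁻¹ π₂ , F⊆P⁻¹ π₃ ]′) ,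
      λ a m → mk⇔ [ [ F⊆P⁻¹ π₁ , F⊆P⁻¹ π₂ ]′ , F⊆P⁻¹ π₃ ]′ (P⁻¹⊆F m)
      where
      P∘position-injective : Injective _≡_ _≡_ (P ∘ position)
      P∘position-injective = position-injective ∘ P-inj

      u : T n k1
      u = P ∘ π₁ , λ e → block₁-injective (P∘position-injective e)
      v : T n k2
      v = P ∘ π₂ , λ e → block₂-injective (P∘position-injective e)
      z : T n k3
      z = P ∘ π₃ , λ e → block₃-injective (P∘position-injective e)

      F⊆P⁻¹ : ∀ {k} (p : Fin k → Fin r) {a m} → Maps (P ∘ p) p a m → P m ≡ a
      F⊆P⁻¹ = Maps-∘⇒inverse P

      P⁻¹⊆F : ∀ {a} m → P m ≡ a → F3 (inj₁ u) (inj₂ (inj₁ v)) (inj₂ (inj₂ z)) a m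
      P⁻¹⊆F m Pm≡a with position-surjective m
      ... | j , posj≡m with blocks-cover j
      ...   | inj₁ (ℓ , e) = inj₁ (inj₁ (inverse⇒Maps-∘ P π₁ ℓ (trans (cong position e) posj≡m) Pm≡a))
      ...   | inj₂ (inj₁ (ℓ , e)) = inj₁ (inj₂ (inverse⇒Maps-∘ P π₂ ℓ (trans (cong position e) posj≡m) Pm≡a))
      ...   | inj₂ (inj₂ (ℓ , e)) = inj₂ (inverse⇒Maps-∘ P π₃ ℓ (trans (cong position e) posj≡m) Pm≡a)

-- The balance conditions ⌊r/3⌋ ≤ kᵢ ≤ ⌈r/3⌉ only matter for the size of G_σ, not for correctness.
lemma7p7 : (n : ℕ) (E : Fin n → Fin n → Set) (r : ℕ) (EM : Fin r → Fin r → Set)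
    (k1 k2 k3 : ℕ) (eq : k1 + k2 + k3 ≡ r)
    → floor3 r ≤ k1 → k1 ≤ ceil3 r
    → floor3 r ≤ k2 → k2 ≤ ceil3 r
    → floor3 r ≤ k3 → k3 ≤ ceil3 r
    → (π : Fin r → Fin r) → Bijective _≡_ _≡_ π
    → (P : Fin r → Fin n)
    → IsInjHom E EM P
      ⇔ Σ (T n k1) (λ u → Σ (T n k2) (λ v → Σ (T n k3) (λ z →
          Gσ.Adj E EM k1 k2 k3 eq π (inj₁ u) (inj₂ (inj₁ v))
          × Gσ.Adj E EM k1 k2 k3 eq π (inj₁ u) (inj₂ (inj₂ z))
          × Gσ.Adj E EM k1 k2 k3 eq π (inj₂ (inj₁ v)) (inj₂ (inj₂ z))
          × ((a : Fin n) (m : Fin r) →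
               Gσ.F3 E EM k1 k2 k3 eq π (inj₁ u) (inj₂ (inj₁ v)) (inj₂ (inj₂ z)) a m
               ⇔ (P m ≡ a)))))
lemma7p7 n E r EM k1 k2 k3 eq _ _ _ _ _ _ π π-bij P =
  mk⇔ (triangle-of-injective-hom π-bij) injective-hom-of-triangle
  where open Triangles E EM k1 k2 k3 eq π
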